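{- For every positive integer $c$ and every $n\ge0$, \[\sum_f u^{\mathrm{lucky}\,f}=P_n(1,u,cu),\] where the sum is over all $c$-parking functions $f:[n]\to[n+c]$.
   Context: Given $f:[n]\to[n+c]$ (car $z$ prefers space $f(z)$), cars $1,\dots,n$ arrive in increasing order; car $z$ parks in the smallest unoccupied space $s$ with $f(z)\le s\le n+c-1$, if one exists, and otherwise does not park. $f$ is a $c$-parking function if all cars park. A car is lucky if it parks in its preferred space; $\mathrm{lucky}\,f$ is the number of lucky cars. $P_n(a,b,c)=c\prod_{i=1}^{n-1}(ia+(n-i)b+c)$ for $n\ge1$, and $P_0=1$. -}

module Defs where

open import Data.Nat using (ℕ; zero; suc; _+_; _∸_; _≡ᵇ_)
open import Data.Bool using (Bool; true; false; if_then_else_; _∨_)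
open import Data.Fin using (Fin; toℕ)
open import Data.Vec using (Vec; []; _∷_)
open import Data.List using (List; []; _∷_; _++_; map; concatMap)
open import Data.Maybe using (Maybe; just; nothing)
open import Data.Fin using () renaming (zero to fz; suc to fs)
open import Algebra.Bundles using (CommutativeSemiring)
open import Level using (Level)

-- A preference function f : [n] → [n+c] is a vector of length n with entries
-- in Fin (n + c); entry x (0-based) encodes the 1-based preference suc (toℕ x).
PrefFun : ℕ → ℕ → Set
PrefFun n c = Vec (Fin (n + c)) n

allFin : (m : ℕ) → List (Fin m)
allFin zero = []
allFin (suc m) = fz ∷ map fs (allFin m)

allVecs : (m k : ℕ) → List (Vec (Fin m) k)
allVecs m zero = [] ∷ []
allVecs m (suc k) = concatMap (λ x → map (x ∷_) (allVecs m k)) (allFin m)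

allPrefFuns : (n c : ℕ) → List (PrefFun n c)
allPrefFuns n c = allVecs (n + c) n

elemᵇ : ℕ → List ℕ → Bool
elemᵇ x [] = false
elemᵇ x (y ∷ ys) = (x ≡ᵇ y) ∨ elemᵇ x ys

firstFree : List ℕ → (k s₀ : ℕ) → Maybe ℕ
firstFree occ zero s = nothing
firstFree occ (suc k) s = if elemᵇ s occ then firstFree occ k (suc s) else just s

-- Parking process with last space L = n+c-1 (spaces 1..L, 1-based).
run : (L : ℕ) → List ℕ → {k m : ℕ} → Vec (Fin m) k → Maybe ℕ
run L occ [] = just 0
run L occ (x ∷ xs) with firstFree occ (suc L ∸ suc (toℕ x)) (suc (toℕ x))
... | nothing = nothing
... | just s with run L (s ∷ occ) xs
...   | nothing = nothing
...   | just r = just ((if s ≡ᵇ suc (toℕ x) then 1 else 0) + r)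

outcome : (n c : ℕ) → PrefFun n c → Maybe ℕ
outcome n c f = run (n + c ∸ 1) [] f

IsParkingFunction : (n c : ℕ) → PrefFun n c → Set
IsParkingFunction n c f with outcome n c f
... | just _ = Data.Unit.⊤ where import Data.Unit
... | nothing = Data.Empty.⊥ where import Data.Empty

module _ {a ℓ : Level} (R : CommutativeSemiring a ℓ) where
  open CommutativeSemiring R renaming (_+_ to _⊕_; _*_ to _⊛_)

  nat : ℕ → Carrier
  nat zero = 0#
  nat (suc k) = 1# ⊕ nat k

  pow : Carrier → ℕ → Carrier
  pow x zero = 1#
  pow x (suc k) = x ⊛ pow x k

  luckySum : (n c : ℕ) → Carrier → Carrier
  luckySum n c u = go (allPrefFuns n c)
    where
    term : PrefFun n c → Carrier
    term f with outcome n c f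
    ... | just l = pow u l
    ... | nothing = 0#
    go : List (PrefFun n c) → Carrier
    go [] = 0#
    go (f ∷ gs) = term f ⊕ go gs

  prodFrom1 : ℕ → (ℕ → Carrier) → Carrier
  prodFrom1 zero g = 1#
  prodFrom1 (suc k) g = prodFrom1 k g ⊛ g (suc k)

  P : ℕ → Carrier → Carrier → Carrier → Carrier
  P zero a b c = 1#
  P (suc m) a b c = c ⊛ prodFrom1 m (λ i → (nat i ⊛ a ⊕ nat (suc m ∸ i) ⊛ b) ⊕ c)

-- Pollak's circle argument. Close the n + c − 1 spaces into a circle with one extra spot N = n + c,
-- so that a car finding no space wraps around; circular parking always succeeds, and it agrees with
-- linear parking, lucky cars included, exactly when spot N stays empty. Rotating the circle takes
-- the sequences whose first car parks at p and leave N empty to those whose first car parks at N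
-- and leave N − p (mod N) empty, so the sum is u times the circular sum with first car at N,
-- weighted by the number of empty spots at the end, which is always c. In the remaining circular
-- sum a car is lucky iff its preferred spot is free, so the car arriving with i spots occupied
-- contributes i + (N − i) u.

module Submission where

open import Defs
open import Level using (Level)
open import Algebra.Bundles using (CommutativeSemiring)
import Algebra.Properties.CommutativeSemigroup as CommutativeSemigroupProperties
open import Data.Bool using (true; false; if_then_else_; _∨_; not; T)
open import Data.Bool.Properties using (not-¬; ∨-zeroʳ)
open import Data.Empty using (⊥-elim)
open import Data.Fin using (Fin; toℕ) renaming (suc to fsuc)
open import Data.Fin.Properties using (toℕ<n)
open import Data.List using (List; []; _∷_; _++_; _∷ʳ_; [_]; map; concatMap; length)
open import Data.List.Properties using (map-∘; map-++; map-id)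
open import Data.List.Membership.Propositional using (_∈_; _∉_)
open import Data.List.Relation.Unary.Any using (here; there)
open import Data.List.Relation.Binary.Permutation.Propositional as ↭
  using (_↭_; ↭-sym; ↭-prep)
open import Data.List.Relation.Binary.Permutation.Propositional.Properties using (∷↭∷ʳ)
open import Data.Maybe using (Maybe; just; nothing; fromMaybe)
open import Data.Nat using (ℕ; zero; suc; pred; _+_; _∸_; _≡ᵇ_; _≤_; _<_; z≤n; s≤s)
import Data.Nat.Properties as ℕ
open import Data.Product using (_×_; _,_; proj₁; proj₂; ∃-syntax)
open import Data.Sum using (_⊎_; inj₁; inj₂)
open import Data.Vec using (Vec; []; _∷_)
open import Function using (_∘_)
open import Function.Definitions using (Injective)
open import Relation.Nullary using (yes; no)
open import Relation.Nullary.Decidable using (dec-true; dec-false)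
import Relation.Binary.Reasoning.Setoid
open import Relation.Binary.PropositionalEquality
  using (_≡_; _≢_; refl; sym; trans; cong; cong₂; subst; module ≡-Reasoning)

≡ᵇ-refl : ∀ x → (x ≡ᵇ x) ≡ true
≡ᵇ-refl x = dec-true (x ℕ.≟ x) refl

≢⇒≡ᵇ-false : ∀ {x y} → x ≢ y → (x ≡ᵇ y) ≡ false
≢⇒≡ᵇ-false {x} {y} = dec-false (x ℕ.≟ y)

≡ᵇ-true⇒≡ : ∀ {x y} → (x ≡ᵇ y) ≡ true → x ≡ y
≡ᵇ-true⇒≡ {x} {y} eq = ℕ.≡ᵇ⇒≡ x y (subst T (sym eq) _)

≡ᵇ-injective : ∀ {f : ℕ → ℕ} → Injective _≡_ _≡_ f → ∀ x y → (f x ≡ᵇ f y) ≡ (x ≡ᵇ y)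
≡ᵇ-injective {f} f-inj x y with x ℕ.≟ y
... | yes refl = trans (≡ᵇ-refl (f x)) (sym (≡ᵇ-refl x))
... | no x≢y   = trans (≢⇒≡ᵇ-false (x≢y ∘ f-inj)) (sym (≢⇒≡ᵇ-false x≢y))

elemᵇ-map-injective : ∀ {f : ℕ → ℕ} → Injective _≡_ _≡_ f → ∀ y ys → elemᵇ (f y) (map f ys) ≡ elemᵇ y ys
elemᵇ-map-injective f-inj y []       = refl
elemᵇ-map-injective f-inj y (z ∷ zs) =
  cong₂ _∨_ (≡ᵇ-injective f-inj y z) (elemᵇ-map-injective f-inj y zs)

elemᵇ-here : ∀ x xs → elemᵇ x (x ∷ xs) ≡ true
elemᵇ-here x xs rewrite ≡ᵇ-refl x = refl

elemᵇ-there : ∀ {x} y xs → elemᵇ x xs ≡ true → elemᵇ x (y ∷ xs) ≡ true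
elemᵇ-there {x} y xs x∈xs rewrite x∈xs = ∨-zeroʳ (x ≡ᵇ y)

elemᵇ-∷-≢ : ∀ {x y} xs → x ≢ y → elemᵇ x (y ∷ xs) ≡ elemᵇ x xs
elemᵇ-∷-≢ xs x≢y rewrite ≢⇒≡ᵇ-false x≢y = refl

firstFree-< : ∀ occ k s {t} → firstFree occ k s ≡ just t → t < s + k
firstFree-< occ (suc k) s {t} eq with elemᵇ s occ
... | true  = subst (t <_) (sym (ℕ.+-suc s k)) (firstFree-< occ k (suc s) eq)
firstFree-< occ (suc k) s refl | false = ℕ.m<m+n s (s≤s z≤n)

range : ℕ → ℕ → List ℕ
range a zero    = []
range a (suc k) = a ∷ range (suc a) k

range-∷ʳ : ∀ a k → range a (suc k) ≡ range a k ∷ʳ (a + k)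
range-∷ʳ a zero    = cong [_] (sym (ℕ.+-identityʳ a))
range-∷ʳ a (suc k) = cong (a ∷_)
  (trans (range-∷ʳ (suc a) k) (cong (range (suc a) k ∷ʳ_) (sym (ℕ.+-suc a k))))

map-suc-range : ∀ a k → map suc (range a k) ≡ range (suc a) k
map-suc-range a zero    = refl
map-suc-range a (suc k) = cong (suc a ∷_) (map-suc-range (suc a) k)

length-range : ∀ a k → length (range a k) ≡ k
length-range a zero    = refl
length-range a (suc k) = cong suc (length-range (suc a) k)

∈-range⁻ : ∀ {x} a k → x ∈ range a k → a ≤ x × x < a + k
∈-range⁻ a (suc k) (here refl) = ℕ.≤-refl , ℕ.m<m+n a (s≤s z≤n)
∈-range⁻ {x} a (suc k) (there x∈) with ∈-range⁻ (suc a) k x∈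
... | a<x , x<a+k = ℕ.<⇒≤ a<x , subst (x <_) (sym (ℕ.+-suc a k)) x<a+k

<⇒∉-range : ∀ {s a} k → s < a → s ∉ range a k
<⇒∉-range k s<a s∈ = ℕ.<⇒≱ s<a (proj₁ (∈-range⁻ _ k s∈))

allFin-range : ∀ m → map (suc ∘ toℕ) (allFin m) ≡ range 1 m
allFin-range zero    = refl
allFin-range (suc m) = cong (1 ∷_) (begin
  map (suc ∘ toℕ) (map fsuc (allFin m))  ≡⟨ sym (map-∘ (allFin m)) ⟩
  map (suc ∘ suc ∘ toℕ) (allFin m)       ≡⟨ map-∘ (allFin m) ⟩
  map suc (map (suc ∘ toℕ) (allFin m))   ≡⟨ cong (map suc) (allFin-range m) ⟩
  map suc (range 1 m)                    ≡⟨ map-suc-range 1 m ⟩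
  range 2 m                              ∎)
  where open ≡-Reasoning

map-∸-range-↭ : ∀ k → map (suc k ∸_) (range 1 k) ↭ range 1 k
map-∸-range-↭ zero    = ↭.refl
map-∸-range-↭ (suc k) = begin
  suc k ∷ map (suc (suc k) ∸_) (range 2 k)            ≡⟨ cong (λ xs → suc k ∷ map (suc (suc k) ∸_) xs)
                                                               (sym (map-suc-range 1 k)) ⟩
  suc k ∷ map (suc (suc k) ∸_) (map suc (range 1 k))  ≡⟨ cong (suc k ∷_) (sym (map-∘ (range 1 k))) ⟩
  suc k ∷ map (suc k ∸_) (range 1 k)                  ↭⟨ ↭-prep (suc k) (map-∸-range-↭ k) ⟩
  suc k ∷ range 1 k                                   ↭⟨ ∷↭∷ʳ (suc k) (range 1 k) ⟩
  range 1 k ∷ʳ suc k                                  ≡⟨ range-∷ʳ 1 k ⟨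
  range 1 (suc k)                                     ∎
  where open ↭.PermutationReasoning

freeCount : List ℕ → List ℕ → ℕ
freeCount []       occ = 0
freeCount (y ∷ ys) occ = (if elemᵇ y occ then 0 else 1) + freeCount ys occ

freeCount-[] : ∀ xs → freeCount xs [] ≡ length xs
freeCount-[] []       = refl
freeCount-[] (x ∷ xs) = cong suc (freeCount-[] xs)

freeCount-≤ : ∀ xs occ → freeCount xs occ ≤ length xs
freeCount-≤ []       occ = z≤n
freeCount-≤ (x ∷ xs) occ with elemᵇ x occ
... | true  = ℕ.m≤n⇒m≤1+n (freeCount-≤ xs occ)
... | false = s≤s (freeCount-≤ xs occ)

freeCount-occupied : ∀ xs occ → (∀ {y} → y ∈ xs → elemᵇ y occ ≡ true) → freeCount xs occ ≡ 0
freeCount-occupied []       occ _        = refl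
freeCount-occupied (y ∷ ys) occ occupied rewrite occupied (here refl) =
  freeCount-occupied ys occ (occupied ∘ there)

freeCount-∉ : ∀ {s} xs occ → s ∉ xs → freeCount xs (s ∷ occ) ≡ freeCount xs occ
freeCount-∉ []       occ s∉ = refl
freeCount-∉ (y ∷ ys) occ s∉ rewrite elemᵇ-∷-≢ occ (λ y≡s → s∉ (here (sym y≡s))) =
  cong (_ +_) (freeCount-∉ ys occ (s∉ ∘ there))

freeCount-range-free : ∀ a k {s} occ → a ≤ s → s < a + k → elemᵇ s occ ≡ false →
                       freeCount (range a k) occ ≡ suc (freeCount (range a k) (s ∷ occ))
freeCount-range-free a zero {s} occ a≤s s<a+0 _ =
  ⊥-elim (ℕ.<⇒≱ (subst (s <_) (ℕ.+-identityʳ a) s<a+0) a≤s)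
freeCount-range-free a (suc k) {s} occ a≤s s<a+k s-free with a ℕ.≟ s
... | yes refl rewrite s-free | ≡ᵇ-refl a =
  cong suc (sym (freeCount-∉ (range (suc a) k) occ (<⇒∉-range k ℕ.≤-refl)))
... | no a≢s rewrite elemᵇ-∷-≢ occ a≢s = trans
  (cong (_ +_) (freeCount-range-free (suc a) k occ (ℕ.≤∧≢⇒< a≤s a≢s)
                                     (subst (s <_) (ℕ.+-suc a k) s<a+k) s-free))
  (ℕ.+-suc _ _)

-- Spots 1 … N on a circle; 0 is what a search that finds every spot occupied returns.
module Circle (M : ℕ) where

  N : ℕ
  N = suc M

  spots : List ℕ
  spots = range 1 N

  ∈-spots⁻ : ∀ {x} → x ∈ spots → 1 ≤ x × x ≤ N
  ∈-spots⁻ x∈ with ∈-range⁻ 1 N x∈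
  ... | 1≤x , s≤s x≤N = 1≤x , x≤N

  rot : ℕ → ℕ
  rot zero    = zero
  rot (suc x) = if suc x ≡ᵇ N then 1 else suc (suc x)

  rotⁱ : ℕ → ℕ → ℕ
  rotⁱ zero    x = x
  rotⁱ (suc j) x = rotⁱ j (rot x)

  search : List ℕ → ℕ → ℕ → ℕ
  search occ zero    x = 0
  search occ (suc f) x = if elemᵇ x occ then search occ f (rot x) else x

  park : List ℕ → ℕ → ℕ
  park occ = search occ N

  freeSpots : List ℕ → ℕ
  freeSpots = freeCount spots

  rot-injective : Injective _≡_ _≡_ rot
  rot-injective {zero}  {zero}  _ = refl
  rot-injective {zero}  {suc y} e with suc y ≡ᵇ N
  rot-injective {zero}  {suc y} () | true
  rot-injective {zero}  {suc y} () | false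
  rot-injective {suc x} {zero}  e = sym (rot-injective (sym e))
  rot-injective {suc x} {suc y} e with suc x ≡ᵇ N in x≡N | suc y ≡ᵇ N in y≡N
  ... | true  | true  = trans (≡ᵇ-true⇒≡ {suc x} {N} x≡N) (sym (≡ᵇ-true⇒≡ {suc y} {N} y≡N))
  ... | false | false = cong pred e
  rot-injective {suc x} {suc y} () | true  | false
  rot-injective {suc x} {suc y} () | false | true

  rot-< : ∀ {x} → 1 ≤ x → x < N → rot x ≡ suc x
  rot-< {suc x} _ x<N rewrite ≢⇒≡ᵇ-false (ℕ.<⇒≢ x<N) = refl

  rot-N : rot N ≡ 1
  rot-N rewrite ≡ᵇ-refl M = refl

  rot-spot : ∀ {x} → 1 ≤ x → x ≤ N → 1 ≤ rot x × rot x ≤ N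
  rot-spot 1≤x x≤N with ℕ.m≤n⇒m<n∨m≡n x≤N
  ... | inj₁ x<N rewrite rot-< 1≤x x<N = s≤s z≤n , x<N
  ... | inj₂ refl rewrite rot-N = ℕ.≤-refl , s≤s z≤n

  rotⁱ-+ : ∀ i j x → rotⁱ (i + j) x ≡ rotⁱ j (rotⁱ i x)
  rotⁱ-+ zero    j x = refl
  rotⁱ-+ (suc i) j x = rotⁱ-+ i j (rot x)

  rotⁱ-unwrapped : ∀ j {x} → 1 ≤ x → x + j ≤ N → rotⁱ j x ≡ x + j
  rotⁱ-unwrapped zero    {x} _   _     = sym (ℕ.+-identityʳ x)
  rotⁱ-unwrapped (suc j) {x} 1≤x x+j≤N
    rewrite rot-< 1≤x (ℕ.<-≤-trans (ℕ.m<m+n x (s≤s z≤n)) x+j≤N) =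
    trans (rotⁱ-unwrapped j (s≤s z≤n) (subst (_≤ N) (ℕ.+-suc x j) x+j≤N)) (sym (ℕ.+-suc x j))

  rotⁱ-to-N : ∀ {x} → 1 ≤ x → x ≤ N → rotⁱ (N ∸ x) x ≡ N
  rotⁱ-to-N {x} 1≤x x≤N =
    trans (rotⁱ-unwrapped (N ∸ x) 1≤x (ℕ.≤-reflexive (ℕ.m+[n∸m]≡n x≤N))) (ℕ.m+[n∸m]≡n x≤N)

  rotⁱ-from-N : ∀ {y} → 1 ≤ y → y ≤ N → rotⁱ y N ≡ y
  rotⁱ-from-N {suc y} _ y<N rewrite rot-N = rotⁱ-unwrapped y ℕ.≤-refl y<N

  rotⁱ-reaches : ∀ {x y} → 1 ≤ x → x ≤ N → 1 ≤ y → y ≤ N → ∃[ j ] (j < N × rotⁱ j x ≡ y)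
  rotⁱ-reaches {x} {y} 1≤x x≤N 1≤y y≤N with x ℕ.≤? y
  ... | yes x≤y = y ∸ x
                , ℕ.<-≤-trans (ℕ.∸-monoʳ-< 1≤x x≤y) y≤N
                , trans (rotⁱ-unwrapped (y ∸ x) 1≤x (subst (_≤ N) (sym (ℕ.m+[n∸m]≡n x≤y)) y≤N))
                        (ℕ.m+[n∸m]≡n x≤y)
  ... | no x≰y = (N ∸ x) + y
               , ℕ.<-≤-trans (ℕ.+-monoʳ-< (N ∸ x) (ℕ.≰⇒> x≰y)) (ℕ.≤-reflexive (ℕ.m∸n+n≡m x≤N))
               , (begin
                   rotⁱ ((N ∸ x) + y) x     ≡⟨ rotⁱ-+ (N ∸ x) y x ⟩
                   rotⁱ y (rotⁱ (N ∸ x) x)  ≡⟨ cong (rotⁱ y) (rotⁱ-to-N 1≤x x≤N) ⟩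
                   rotⁱ y N                 ≡⟨ rotⁱ-from-N 1≤y y≤N ⟩
                   y                        ∎)
    where open ≡-Reasoning

  map-rot-range : ∀ a k → 1 ≤ a → a + k ≤ N → map rot (range a k) ≡ range (suc a) k
  map-rot-range a zero    _   _     = refl
  map-rot-range a (suc k) 1≤a a+k≤N = cong₂ _∷_
    (rot-< 1≤a (ℕ.<-≤-trans (ℕ.m<m+n a (s≤s z≤n)) a+k≤N))
    (map-rot-range (suc a) k (s≤s z≤n) (subst (_≤ N) (ℕ.+-suc a k) a+k≤N))

  map-rot-spots : map rot spots ↭ spots
  map-rot-spots = begin
    map rot spots                    ≡⟨ cong (map rot) (range-∷ʳ 1 M) ⟩
    map rot (range 1 M ∷ʳ N)         ≡⟨ map-++ rot (range 1 M) [ N ] ⟩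
    map rot (range 1 M) ∷ʳ rot N     ≡⟨ cong₂ _∷ʳ_ (map-rot-range 1 M ℕ.≤-refl ℕ.≤-refl) rot-N ⟩
    range 2 M ∷ʳ 1                   ↭⟨ ∷↭∷ʳ 1 (range 2 M) ⟨
    spots                            ∎
    where open ↭.PermutationReasoning

  search-rot : ∀ occ f x → search (map rot occ) f (rot x) ≡ rot (search occ f x)
  search-rot occ zero    x = refl
  search-rot occ (suc f) x rewrite elemᵇ-map-injective rot-injective x occ with elemᵇ x occ
  ... | true  = search-rot occ f (rot x)
  ... | false = refl

  search-fail : ∀ occ f j {x} → 1 ≤ x → x ≤ N → j < f → search occ f x ≡ 0 →
                elemᵇ (rotⁱ j x) occ ≡ true
  search-fail occ (suc f) j {x} 1≤x x≤N j<f fails with elemᵇ x occ in x-occupied | j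
  ... | false | _     = ⊥-elim (ℕ.<⇒≢ 1≤x (sym fails))
  ... | true  | zero  = x-occupied
  ... | true  | suc i =
    search-fail occ f i (proj₁ (rot-spot 1≤x x≤N)) (proj₂ (rot-spot 1≤x x≤N)) (ℕ.≤-pred j<f) fails

  search-result : ∀ occ f {x} → 1 ≤ x → x ≤ N →
                  search occ f x ≡ 0 ⊎
                  (elemᵇ (search occ f x) occ ≡ false × 1 ≤ search occ f x × search occ f x ≤ N)
  search-result occ zero    _   _   = inj₁ refl
  search-result occ (suc f) {x} 1≤x x≤N with elemᵇ x occ in x-occupied
  ... | true  = search-result occ f (proj₁ (rot-spot 1≤x x≤N)) (proj₂ (rot-spot 1≤x x≤N))
  ... | false = inj₂ (x-occupied , 1≤x , x≤N)

  park-lucky : ∀ occ {x} → 1 ≤ x → x ≤ N → (park occ x ≡ᵇ x) ≡ not (elemᵇ x occ)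
  park-lucky occ {x} 1≤x x≤N with elemᵇ x occ in x-occupied
  ... | false = ≡ᵇ-refl x
  ... | true with search-result occ M (proj₁ (rot-spot 1≤x x≤N)) (proj₂ (rot-spot 1≤x x≤N))
  ...   | inj₁ fails rewrite fails = ≢⇒≡ᵇ-false (ℕ.<⇒≢ 1≤x)
  ...   | inj₂ (s-free , _) = ≢⇒≡ᵇ-false λ s≡x →
    not-¬ refl (trans (sym x-occupied) (subst (λ z → elemᵇ z occ ≡ false) s≡x s-free))

  park-fail : ∀ occ {x} → 1 ≤ x → x ≤ N → park occ x ≡ 0 → ∀ {y} → y ∈ spots → elemᵇ y occ ≡ true
  park-fail occ 1≤x x≤N fails y∈ with ∈-spots⁻ y∈
  ... | 1≤y , y≤N with rotⁱ-reaches 1≤x x≤N 1≤y y≤N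
  ...   | j , j<N , reaches =
    subst (λ z → elemᵇ z occ ≡ true) reaches (search-fail occ N j 1≤x x≤N j<N fails)

  -- When the circle is full, park returns 0 and both sides are 0.
  freeSpots-park : ∀ occ {x} → 1 ≤ x → x ≤ N → freeSpots (park occ x ∷ occ) ≡ freeSpots occ ∸ 1
  freeSpots-park occ 1≤x x≤N with search-result occ N 1≤x x≤N
  ... | inj₁ fails rewrite fails
                         | freeCount-∉ spots occ (<⇒∉-range N (s≤s z≤n))
                         | freeCount-occupied spots occ (park-fail occ 1≤x x≤N fails) = refl
  ... | inj₂ (s-free , 1≤s , s≤N) = cong pred (sym (freeCount-range-free 1 N occ 1≤s (s≤s s≤N) s-free))

  freeSpots-[N] : freeSpots [ N ] ≡ M
  freeSpots-[N] = ℕ.suc-injective (begin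
    suc (freeSpots [ N ])   ≡⟨ sym (freeCount-range-free 1 N [] (s≤s z≤n) ℕ.≤-refl refl) ⟩
    freeCount spots []      ≡⟨ freeCount-[] spots ⟩
    length spots            ≡⟨ length-range 1 N ⟩
    N                       ∎)
    where open ≡-Reasoning

  search-linear : ∀ occ k f {s} → elemᵇ N occ ≡ false → 1 ≤ s → s + k ≡ N → k < f →
                  search occ f s ≡ fromMaybe N (firstFree occ k s)
  search-linear occ zero (suc f) {s} N-free _ s+0≡N _ with trans (sym (ℕ.+-identityʳ s)) s+0≡N
  ... | refl rewrite N-free = refl
  search-linear occ (suc k) (suc f) {s} N-free 1≤s s+k≡N (s≤s k<f) with elemᵇ s occ
  ... | false = refl
  ... | true rewrite rot-< 1≤s (subst (s <_) s+k≡N (ℕ.m<m+n s (s≤s z≤n))) =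
    search-linear occ k f N-free (s≤s z≤n) (trans (sym (ℕ.+-suc s k)) s+k≡N) k<f

  firstFree-window : ∀ (x : Fin N) → suc (toℕ x) + (M ∸ toℕ x) ≡ N
  firstFree-window x = cong suc (ℕ.m+[n∸m]≡n (ℕ.≤-pred (toℕ<n x)))

  park-firstFree : ∀ occ (x : Fin N) {r} → elemᵇ N occ ≡ false →
                   firstFree occ (M ∸ toℕ x) (suc (toℕ x)) ≡ r → park occ (suc (toℕ x)) ≡ fromMaybe N r
  park-firstFree occ x N-free found = trans
    (search-linear occ (M ∸ toℕ x) N N-free (s≤s z≤n) (firstFree-window x) (s≤s (ℕ.m∸n≤m M (toℕ x))))
    (cong (fromMaybe N) found)

  firstFree-<N : ∀ occ (x : Fin N) {t} → firstFree occ (M ∸ toℕ x) (suc (toℕ x)) ≡ just t → t < N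
  firstFree-<N occ x {t} found = subst (t <_) (firstFree-window x) (firstFree-< occ (M ∸ toℕ x) _ found)

module ListSum {a ℓ : Level} (R : CommutativeSemiring a ℓ) where
  open CommutativeSemiring R
    renaming (_+_ to _⊕_; _*_ to _⊛_; refl to ≈-refl; sym to ≈-sym; trans to ≈-trans)
  open CommutativeSemigroupProperties +-commutativeSemigroup using (interchange; x∙yz≈y∙xz)

  private variable A B : Set

  Σ : List A → (A → Carrier) → Carrier
  Σ []       h = 0#
  Σ (x ∷ xs) h = h x ⊕ Σ xs h

  Σ-cong-∈ : ∀ (xs : List A) {h g : A → Carrier} → (∀ {x} → x ∈ xs → h x ≈ g x) → Σ xs h ≈ Σ xs g
  Σ-cong-∈ []       h≈g = ≈-refl
  Σ-cong-∈ (x ∷ xs) h≈g = +-cong (h≈g (here refl)) (Σ-cong-∈ xs (h≈g ∘ there))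

  Σ-cong : ∀ (xs : List A) {h g : A → Carrier} → (∀ x → h x ≈ g x) → Σ xs h ≈ Σ xs g
  Σ-cong xs h≈g = Σ-cong-∈ xs (λ {x} _ → h≈g x)

  Σ-map : ∀ (f : A → B) xs (h : B → Carrier) → Σ (map f xs) h ≡ Σ xs (h ∘ f)
  Σ-map f []       h = refl
  Σ-map f (x ∷ xs) h = cong (h (f x) ⊕_) (Σ-map f xs h)

  Σ-++ : ∀ (xs ys : List A) h → Σ (xs ++ ys) h ≈ Σ xs h ⊕ Σ ys h
  Σ-++ []       ys h = ≈-sym (+-identityˡ _)
  Σ-++ (x ∷ xs) ys h = ≈-trans (+-cong ≈-refl (Σ-++ xs ys h)) (≈-sym (+-assoc _ _ _))

  Σ-concatMap : ∀ (f : A → List B) xs h → Σ (concatMap f xs) h ≈ Σ xs (λ x → Σ (f x) h)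
  Σ-concatMap f []       h = ≈-refl
  Σ-concatMap f (x ∷ xs) h =
    ≈-trans (Σ-++ (f x) (concatMap f xs) h) (+-cong ≈-refl (Σ-concatMap f xs h))

  Σ-*ˡ : ∀ c (xs : List A) h → c ⊛ Σ xs h ≈ Σ xs (λ x → c ⊛ h x)
  Σ-*ˡ c []       h = zeroʳ c
  Σ-*ˡ c (x ∷ xs) h = ≈-trans (distribˡ c _ _) (+-cong ≈-refl (Σ-*ˡ c xs h))

  Σ-*ʳ : ∀ c (xs : List A) h → Σ xs h ⊛ c ≈ Σ xs (λ x → h x ⊛ c)
  Σ-*ʳ c []       h = zeroˡ c
  Σ-*ʳ c (x ∷ xs) h = ≈-trans (distribʳ c _ _) (+-cong ≈-refl (Σ-*ʳ c xs h))

  Σ-zero : ∀ (xs : List A) → Σ xs (λ _ → 0#) ≈ 0#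
  Σ-zero []       = ≈-refl
  Σ-zero (x ∷ xs) = ≈-trans (+-identityˡ _) (Σ-zero xs)

  Σ-+ : ∀ (xs : List A) h g → Σ xs (λ x → h x ⊕ g x) ≈ Σ xs h ⊕ Σ xs g
  Σ-+ []       h g = ≈-sym (+-identityˡ 0#)
  Σ-+ (x ∷ xs) h g = ≈-trans (+-cong ≈-refl (Σ-+ xs h g)) (interchange _ _ _ _)

  Σ-comm : ∀ (xs : List A) (ys : List B) (h : A → B → Carrier) →
           Σ xs (λ x → Σ ys (h x)) ≈ Σ ys (λ y → Σ xs (λ x → h x y))
  Σ-comm []       ys h = ≈-sym (Σ-zero ys)
  Σ-comm (x ∷ xs) ys h = ≈-trans (+-cong ≈-refl (Σ-comm xs ys h)) (≈-sym (Σ-+ ys (h x) _))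

  Σ-↭ : ∀ {xs ys : List A} h → xs ↭ ys → Σ xs h ≈ Σ ys h
  Σ-↭ h ↭.refl                       = ≈-refl
  Σ-↭ h (↭.prep x xs↭ys)             = +-cong ≈-refl (Σ-↭ h xs↭ys)
  Σ-↭ h (↭.swap x y xs↭ys)           =
    ≈-trans (x∙yz≈y∙xz _ _ _) (+-cong ≈-refl (+-cong ≈-refl (Σ-↭ h xs↭ys)))
  Σ-↭ h (↭.trans xs↭ys ys↭zs)        = ≈-trans (Σ-↭ h xs↭ys) (Σ-↭ h ys↭zs)

  Σ-unique : ∀ (h : A → Carrier) (G : List A → Carrier) (T : A → Carrier) → G [] ≈ 0# →
             (∀ x xs → G (x ∷ xs) ≡ T x ⊕ G xs) → (∀ x → T x ≈ h x) → ∀ xs → G xs ≈ Σ xs h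
  Σ-unique h G T G[] G∷ T≈h []       = G[]
  Σ-unique h G T G[] G∷ T≈h (x ∷ xs) =
    ≈-trans (reflexive (G∷ x xs)) (+-cong (T≈h x) (Σ-unique h G T G[] G∷ T≈h xs))

module Parking {a ℓ : Level} (R : CommutativeSemiring a ℓ) (u : CommutativeSemiring.Carrier R) where
  open CommutativeSemiring R
    renaming (_+_ to _⊕_; _*_ to _⊛_; refl to ≈-refl; sym to ≈-sym; trans to ≈-trans)
  open CommutativeSemigroupProperties +-commutativeSemigroup using () renaming (x∙yz≈y∙xz to +-leftComm)
  open CommutativeSemigroupProperties *-commutativeSemigroup using () renaming (x∙yz≈y∙xz to *-leftComm)
  open Relation.Binary.Reasoning.Setoid setoid
  open ListSum R

  nat-+ : ∀ m n → nat R (m + n) ≈ nat R m ⊕ nat R n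
  nat-+ zero    n = ≈-sym (+-identityˡ _)
  nat-+ (suc m) n = ≈-trans (+-cong ≈-refl (nat-+ m n)) (≈-sym (+-assoc _ _ _))

  weight : Maybe ℕ → Carrier
  weight nothing  = 0#
  weight (just l) = pow R u l

  weight-elim : ∀ {A : Set} (t : A → Maybe ℕ → Carrier) →
                (∀ x → t x nothing ≈ 0#) → (∀ x l → t x (just l) ≈ pow R u l) → ∀ x m → t x m ≈ weight m
  weight-elim t t₀ tⱼ x nothing  = t₀ x
  weight-elim t t₀ tⱼ x (just l) = tⱼ x l

  -- The summand of luckySum is local to Defs, so it is reached through unification: the with
  -- on the list fixes the fold G, and the with on the head's outcome fixes the summand t.
  luckySum-Σ : ∀ n c → luckySum R n c u ≈ Σ (allPrefFuns n c) (weight ∘ outcome n c)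
  luckySum-Σ n c
    with allPrefFuns n c
       | Σ-unique (weight ∘ outcome n c) _ _ ≈-refl (λ _ _ → refl)
       | weight-elim _ (λ _ → ≈-refl) (λ _ _ → ≈-refl)
  ... | []     | _     | _       = ≈-refl
  ... | f ∷ fs | sum≈Σ | t≈weight with outcome n c f
  ...   | m = +-cong (t≈weight f m) (sum≈Σ (λ g → t≈weight g (outcome n c g)) fs)

  Σ-occupancy : ∀ xs occ → Σ xs (λ x → if elemᵇ x occ then 1# else u)
                           ≈ nat R (length xs ∸ freeCount xs occ) ⊕ nat R (freeCount xs occ) ⊛ u
  Σ-occupancy []       occ = ≈-sym (≈-trans (+-identityˡ _) (zeroˡ u))
  Σ-occupancy (x ∷ xs) occ with elemᵇ x occ
  ... | true  = begin
    1# ⊕ Σ xs _                                               ≈⟨ +-cong ≈-refl (Σ-occupancy xs occ) ⟩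
    1# ⊕ (nat R (length xs ∸ free) ⊕ nat R free ⊛ u)          ≈⟨ ≈-sym (+-assoc _ _ _) ⟩
    nat R (suc (length xs ∸ free)) ⊕ nat R free ⊛ u           ≡⟨ cong (λ k → nat R k ⊕ nat R free ⊛ u)
                                                                      (sym (ℕ.+-∸-assoc 1 (freeCount-≤ xs occ))) ⟩
    nat R (suc (length xs) ∸ free) ⊕ nat R free ⊛ u           ∎
    where
    free : ℕ
    free = freeCount xs occ
  ... | false = begin
    u ⊕ Σ xs _                                                ≈⟨ +-cong ≈-refl (Σ-occupancy xs occ) ⟩
    u ⊕ (nat R (length xs ∸ free) ⊕ nat R free ⊛ u)           ≈⟨ +-leftComm _ _ _ ⟩
    nat R (length xs ∸ free) ⊕ (u ⊕ nat R free ⊛ u)           ≈⟨ +-cong ≈-refl (+-cong (*-identityˡ u) ≈-refl) ⟨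
    nat R (length xs ∸ free) ⊕ (1# ⊛ u ⊕ nat R free ⊛ u)      ≈⟨ +-cong ≈-refl (≈-sym (distribʳ u _ _)) ⟩
    nat R (length xs ∸ free) ⊕ nat R (suc free) ⊛ u           ∎
    where
    free : ℕ
    free = freeCount xs occ

  module Circular (M : ℕ) where
    open Circle M

    isFree : ℕ → List ℕ → Carrier
    isFree e occ = if elemᵇ e occ then 0# else 1#

    luck : List ℕ → ℕ → Carrier
    luck occ x = if park occ x ≡ᵇ x then u else 1#

    -- The sum over all preference sequences x₁ … x_k ∈ [1, N] of u ^ (number of lucky cars) times
    -- ψ (final occupancy), when the cars park on a circle of N spots that already holds occ.
    circularSum : List ℕ → ℕ → (List ℕ → Carrier) → Carrier
    circularSum occ zero    ψ = ψ occ
    circularSum occ (suc k) ψ = Σ spots (λ x → luck occ x ⊛ circularSum (park occ x ∷ occ) k ψ)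

    circularSum-cong : ∀ k occ {ψ ψ′ : List ℕ → Carrier} → (∀ o → ψ o ≈ ψ′ o) →
                       circularSum occ k ψ ≈ circularSum occ k ψ′
    circularSum-cong zero    occ ψ≈ψ′ = ψ≈ψ′ occ
    circularSum-cong (suc k) occ ψ≈ψ′ = Σ-cong spots (λ x → *-cong ≈-refl (circularSum-cong k _ ψ≈ψ′))

    circularSum-occupied : ∀ k occ e → elemᵇ e occ ≡ true → circularSum occ k (isFree e) ≈ 0#
    circularSum-occupied zero    occ e e-occupied rewrite e-occupied = ≈-refl
    circularSum-occupied (suc k) occ e e-occupied = begin
      Σ spots (λ x → luck occ x ⊛ circularSum (park occ x ∷ occ) k (isFree e))
        ≈⟨ Σ-cong spots (λ x → *-cong ≈-refl
             (circularSum-occupied k _ e (elemᵇ-there (park occ x) occ e-occupied))) ⟩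
      Σ spots (λ x → luck occ x ⊛ 0#)   ≈⟨ Σ-cong spots (λ x → zeroʳ _) ⟩
      Σ spots (λ _ → 0#)                 ≈⟨ Σ-zero spots ⟩
      0#                                 ∎

    circularSum-Σ : ∀ {A : Set} (es : List A) (ψ : A → List ℕ → Carrier) k occ →
                    Σ es (λ e → circularSum occ k (ψ e)) ≈ circularSum occ k (λ o → Σ es (λ e → ψ e o))
    circularSum-Σ es ψ zero    occ = ≈-refl
    circularSum-Σ es ψ (suc k) occ = begin
      Σ es (λ e → Σ spots (λ x → luck occ x ⊛ circularSum (park occ x ∷ occ) k (ψ e)))
        ≈⟨ Σ-comm es spots _ ⟩
      Σ spots (λ x → Σ es (λ e → luck occ x ⊛ circularSum (park occ x ∷ occ) k (ψ e)))
        ≈⟨ Σ-cong spots (λ x → ≈-sym (Σ-*ˡ _ es _)) ⟩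
      Σ spots (λ x → luck occ x ⊛ Σ es (λ e → circularSum (park occ x ∷ occ) k (ψ e)))
        ≈⟨ Σ-cong spots (λ x → *-cong ≈-refl (circularSum-Σ es ψ k _)) ⟩
      Σ spots (λ x → luck occ x ⊛ circularSum (park occ x ∷ occ) k (λ o → Σ es (λ e → ψ e o)))
        ∎

    Σ-spots-rot : ∀ h → Σ spots h ≈ Σ spots (h ∘ rot)
    Σ-spots-rot h = ≈-trans (≈-sym (Σ-↭ h map-rot-spots)) (reflexive (Σ-map rot spots h))

    circularSum-rot : ∀ k occ (ψ ψ′ : List ℕ → Carrier) → (∀ o → ψ′ (map rot o) ≈ ψ o) →
                      circularSum (map rot occ) k ψ′ ≈ circularSum occ k ψ
    circularSum-rot zero    occ ψ ψ′ ψ′≈ψ = ψ′≈ψ occ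
    circularSum-rot (suc k) occ ψ ψ′ ψ′≈ψ =
      ≈-trans (Σ-spots-rot _) (Σ-cong spots rotated-car)
      where
      rotated-car : ∀ x → luck (map rot occ) (rot x)
                            ⊛ circularSum (park (map rot occ) (rot x) ∷ map rot occ) k ψ′
                          ≈ luck occ x ⊛ circularSum (park occ x ∷ occ) k ψ
      rotated-car x rewrite search-rot occ N x | ≡ᵇ-injective rot-injective (park occ x) x =
        *-cong ≈-refl (circularSum-rot k (park occ x ∷ occ) ψ ψ′ ψ′≈ψ)

    circularSum-rotⁱ : ∀ d k occ e → circularSum (map (rotⁱ d) occ) k (isFree (rotⁱ d e))
                                     ≈ circularSum occ k (isFree e)
    circularSum-rotⁱ zero    k occ e = reflexive (cong (λ o → circularSum o k (isFree e)) (map-id occ))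
    circularSum-rotⁱ (suc d) k occ e = begin
      circularSum (map (rotⁱ (suc d)) occ) k (isFree (rotⁱ d (rot e)))
        ≡⟨ cong (λ o → circularSum o k (isFree (rotⁱ d (rot e)))) (map-∘ occ) ⟩
      circularSum (map (rotⁱ d) (map rot occ)) k (isFree (rotⁱ d (rot e)))
        ≈⟨ circularSum-rotⁱ d k (map rot occ) (rot e) ⟩
      circularSum (map rot occ) k (isFree (rot e))
        ≈⟨ circularSum-rot k occ (isFree e) (isFree (rot e))
             (λ o → reflexive (cong (if_then 0# else 1#) (elemᵇ-map-injective rot-injective e o))) ⟩
      circularSum occ k (isFree e)
        ∎

    mirror : ℕ → ℕ
    mirror p = rotⁱ (N ∸ p) N

    mirror-< : ∀ {p} → 1 ≤ p → p < N → mirror p ≡ N ∸ p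
    mirror-< {p} 1≤p p<N = rotⁱ-from-N (ℕ.m<n⇒0<n∸m p<N) (ℕ.m∸n≤m N p)

    mirror-N : mirror N ≡ N
    mirror-N rewrite ℕ.n∸n≡0 N = refl

    Σ-mirror : ∀ h → Σ spots (h ∘ mirror) ≈ Σ spots h
    Σ-mirror h = begin
      Σ spots (h ∘ mirror)                        ≡⟨ cong (λ xs → Σ xs (h ∘ mirror)) (range-∷ʳ 1 M) ⟩
      Σ (range 1 M ∷ʳ N) (h ∘ mirror)             ≈⟨ Σ-↭ _ (↭-sym (∷↭∷ʳ N (range 1 M))) ⟩
      h (mirror N) ⊕ Σ (range 1 M) (h ∘ mirror)   ≈⟨ +-cong (reflexive (cong h mirror-N))
                                                              (Σ-cong-∈ (range 1 M) mirror-below-N) ⟩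
      h N ⊕ Σ (range 1 M) (h ∘ (N ∸_))            ≡⟨ cong (h N ⊕_) (sym (Σ-map (N ∸_) (range 1 M) h)) ⟩
      h N ⊕ Σ (map (N ∸_) (range 1 M)) h          ≈⟨ +-cong ≈-refl (Σ-↭ h (map-∸-range-↭ M)) ⟩
      Σ (N ∷ range 1 M) h                         ≈⟨ Σ-↭ h (∷↭∷ʳ N (range 1 M)) ⟩
      Σ (range 1 M ∷ʳ N) h                        ≡⟨ cong (λ xs → Σ xs h) (range-∷ʳ 1 M) ⟨
      Σ spots h                                   ∎
      where
      mirror-below-N : ∀ {p} → p ∈ range 1 M → h (mirror p) ≈ h (N ∸ p)
      mirror-below-N p∈ with ∈-range⁻ 1 M p∈
      ... | 1≤p , p<N = reflexive (cong h (mirror-< 1≤p p<N))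

    Σ-first-car : ∀ m → Σ spots (λ p → circularSum [ p ] m (isFree N))
                        ≈ Σ spots (λ e → circularSum [ N ] m (isFree e))
    Σ-first-car m = ≈-trans (Σ-cong-∈ spots rotate-to-N) (Σ-mirror (λ e → circularSum [ N ] m (isFree e)))
      where
      rotate-to-N : ∀ {p} → p ∈ spots →
                    circularSum [ p ] m (isFree N) ≈ circularSum [ N ] m (isFree (mirror p))
      rotate-to-N {p} p∈ with ∈-spots⁻ p∈
      ... | 1≤p , p≤N = ≈-sym (≈-trans
        (reflexive (cong (λ q → circularSum [ q ] m (isFree (mirror p))) (sym (rotⁱ-to-N 1≤p p≤N))))
        (circularSum-rotⁱ (N ∸ p) m [ p ] N))

    Σ-isFree : ∀ xs occ → Σ xs (λ e → isFree e occ) ≈ nat R (freeCount xs occ)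
    Σ-isFree []       occ = ≈-refl
    Σ-isFree (x ∷ xs) occ with elemᵇ x occ
    ... | true  = ≈-trans (+-identityˡ _) (Σ-isFree xs occ)
    ... | false = +-cong ≈-refl (Σ-isFree xs occ)

    luck-spot : ∀ occ {x} → 1 ≤ x → x ≤ N → luck occ x ≡ (if elemᵇ x occ then 1# else u)
    luck-spot occ {x} 1≤x x≤N rewrite park-lucky occ 1≤x x≤N with elemᵇ x occ
    ... | true  = refl
    ... | false = refl

    Σ-luck : ∀ occ → Σ spots (luck occ) ≈ nat R (N ∸ freeSpots occ) ⊕ nat R (freeSpots occ) ⊛ u
    Σ-luck occ = begin
      Σ spots (luck occ)
        ≈⟨ Σ-cong-∈ spots (λ x∈ → reflexive (luck-spot occ (proj₁ (∈-spots⁻ x∈)) (proj₂ (∈-spots⁻ x∈)))) ⟩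
      Σ spots (λ x → if elemᵇ x occ then 1# else u)
        ≈⟨ Σ-occupancy spots occ ⟩
      nat R (length spots ∸ freeSpots occ) ⊕ nat R (freeSpots occ) ⊛ u
        ≡⟨ cong (λ n → nat R (n ∸ freeSpots occ) ⊕ nat R (freeSpots occ) ⊛ u) (length-range 1 N) ⟩
      nat R (N ∸ freeSpots occ) ⊕ nat R (freeSpots occ) ⊛ u
        ∎

    circularSum-freeSpots : ∀ k occ → circularSum occ k (nat R ∘ freeSpots)
                                      ≈ nat R (freeSpots occ ∸ k) ⊛ circularSum occ k (λ _ → 1#)
    circularSum-freeSpots zero    occ = ≈-sym (*-identityʳ _)
    circularSum-freeSpots (suc k) occ = begin
      Σ spots (λ x → luck occ x ⊛ circularSum (park occ x ∷ occ) k (nat R ∘ freeSpots))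
        ≈⟨ Σ-cong-∈ spots (λ x∈ → *-cong ≈-refl (circularSum-freeSpots k _)) ⟩
      Σ spots (λ x → luck occ x ⊛ (nat R (freeSpots (park occ x ∷ occ) ∸ k) ⊛ rest x))
        ≈⟨ Σ-cong-∈ spots one-fewer ⟩
      Σ spots (λ x → nat R (freeSpots occ ∸ suc k) ⊛ (luck occ x ⊛ rest x))
        ≈⟨ ≈-sym (Σ-*ˡ _ spots _) ⟩
      nat R (freeSpots occ ∸ suc k) ⊛ Σ spots (λ x → luck occ x ⊛ rest x)
        ∎
      where
      rest : ℕ → Carrier
      rest x = circularSum (park occ x ∷ occ) k (λ _ → 1#)
      one-fewer : ∀ {x} → x ∈ spots → luck occ x ⊛ (nat R (freeSpots (park occ x ∷ occ) ∸ k) ⊛ rest x)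
                                      ≈ nat R (freeSpots occ ∸ suc k) ⊛ (luck occ x ⊛ rest x)
      one-fewer x∈ rewrite freeSpots-park occ (proj₁ (∈-spots⁻ x∈)) (proj₂ (∈-spots⁻ x∈))
                         | ℕ.∸-+-assoc (freeSpots occ) 1 k = *-leftComm _ _ _

    stepProduct : ℕ → ℕ → Carrier
    stepProduct e zero    = 1#
    stepProduct e (suc k) = (nat R (N ∸ e) ⊕ nat R e ⊛ u) ⊛ stepProduct (e ∸ 1) k

    circularSum-one : ∀ k occ → circularSum occ k (λ _ → 1#) ≈ stepProduct (freeSpots occ) k
    circularSum-one zero    occ = ≈-refl
    circularSum-one (suc k) occ = begin
      Σ spots (λ x → luck occ x ⊛ circularSum (park occ x ∷ occ) k (λ _ → 1#))
        ≈⟨ Σ-cong-∈ spots (λ x∈ → *-cong ≈-refl (≈-trans (circularSum-one k _)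
             (reflexive (cong (λ e → stepProduct e k)
               (freeSpots-park occ (proj₁ (∈-spots⁻ x∈)) (proj₂ (∈-spots⁻ x∈))))))) ⟩
      Σ spots (λ x → luck occ x ⊛ stepProduct (freeSpots occ ∸ 1) k)
        ≈⟨ ≈-sym (Σ-*ʳ _ spots _) ⟩
      Σ spots (luck occ) ⊛ stepProduct (freeSpots occ ∸ 1) k
        ≈⟨ *-cong (Σ-luck occ) ≈-refl ⟩
      (nat R (N ∸ freeSpots occ) ⊕ nat R (freeSpots occ) ⊛ u) ⊛ stepProduct (freeSpots occ ∸ 1) k
        ∎

    circularSum-N-free : ∀ m → circularSum [] (suc m) (isFree N) ≈ u ⊛ (nat R (M ∸ m) ⊛ stepProduct M m)
    circularSum-N-free m = begin
      Σ spots (λ p → luck [] p ⊛ circularSum [ p ] m (isFree N))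
        ≈⟨ Σ-cong spots (λ p → *-cong (reflexive (cong (if_then u else 1#) (≡ᵇ-refl p))) ≈-refl) ⟩
      Σ spots (λ p → u ⊛ circularSum [ p ] m (isFree N))
        ≈⟨ ≈-sym (Σ-*ˡ u spots _) ⟩
      u ⊛ Σ spots (λ p → circularSum [ p ] m (isFree N))
        ≈⟨ *-cong ≈-refl (Σ-first-car m) ⟩
      u ⊛ Σ spots (λ e → circularSum [ N ] m (isFree e))
        ≈⟨ *-cong ≈-refl (circularSum-Σ spots isFree m [ N ]) ⟩
      u ⊛ circularSum [ N ] m (λ o → Σ spots (λ e → isFree e o))
        ≈⟨ *-cong ≈-refl (circularSum-cong m [ N ] (Σ-isFree spots)) ⟩
      u ⊛ circularSum [ N ] m (nat R ∘ freeSpots)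
        ≈⟨ *-cong ≈-refl (circularSum-freeSpots m [ N ]) ⟩
      u ⊛ (nat R (freeSpots [ N ] ∸ m) ⊛ circularSum [ N ] m (λ _ → 1#))
        ≈⟨ *-cong ≈-refl (*-cong ≈-refl (circularSum-one m [ N ])) ⟩
      u ⊛ (nat R (freeSpots [ N ] ∸ m) ⊛ stepProduct (freeSpots [ N ]) m)
        ≡⟨ cong (λ e → u ⊛ (nat R (e ∸ m) ⊛ stepProduct e m)) freeSpots-[N] ⟩
      u ⊛ (nat R (M ∸ m) ⊛ stepProduct M m)
        ∎

    linearSum : List ℕ → ℕ → Carrier
    linearSum occ k = Σ (allVecs N k) (weight ∘ run M occ)

    weight-run-blocked : ∀ occ {k} (x : Fin N) (v : Vec (Fin N) k) →
                         firstFree occ (M ∸ toℕ x) (suc (toℕ x)) ≡ nothing → weight (run M occ (x ∷ v)) ≈ 0#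
    weight-run-blocked occ x v blocked rewrite blocked = ≈-refl

    weight-run-parks : ∀ occ {k} (x : Fin N) (v : Vec (Fin N) k) {t} →
                       firstFree occ (M ∸ toℕ x) (suc (toℕ x)) ≡ just t →
                       weight (run M occ (x ∷ v))
                         ≈ (if t ≡ᵇ suc (toℕ x) then u else 1#) ⊛ weight (run M (t ∷ occ) v)
    weight-run-parks occ x v {t} parks rewrite parks with run M (t ∷ occ) v
    ... | nothing = ≈-sym (zeroʳ _)
    ... | just r with t ≡ᵇ suc (toℕ x)
    ...   | true  = ≈-refl
    ...   | false = ≈-sym (*-identityˡ _)

    linearSum-circularSum : ∀ k occ → elemᵇ N occ ≡ false → linearSum occ k ≈ circularSum occ k (isFree N)

    linearSum-first-car : ∀ k occ (x : Fin N) r → elemᵇ N occ ≡ false →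
                          firstFree occ (M ∸ toℕ x) (suc (toℕ x)) ≡ r →
                          Σ (allVecs N k) (λ v → weight (run M occ (x ∷ v)))
                            ≈ luck occ (suc (toℕ x)) ⊛ circularSum (park occ (suc (toℕ x)) ∷ occ) k (isFree N)

    linearSum-circularSum zero    occ N-free rewrite N-free = +-identityʳ 1#
    linearSum-circularSum (suc k) occ N-free = begin
      Σ (concatMap (λ x → map (x ∷_) (allVecs N k)) (allFin N)) (weight ∘ run M occ)
        ≈⟨ Σ-concatMap (λ x → map (x ∷_) (allVecs N k)) (allFin N) (weight ∘ run M occ) ⟩
      Σ (allFin N) (λ x → Σ (map (x ∷_) (allVecs N k)) (weight ∘ run M occ))
        ≈⟨ Σ-cong (allFin N) (λ x → reflexive (Σ-map (x ∷_) (allVecs N k) _)) ⟩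
      Σ (allFin N) (λ x → Σ (allVecs N k) (λ v → weight (run M occ (x ∷ v))))
        ≈⟨ Σ-cong (allFin N) (λ x → linearSum-first-car k occ x _ N-free refl) ⟩
      Σ (allFin N) (next ∘ suc ∘ toℕ)
        ≡⟨ Σ-map (suc ∘ toℕ) (allFin N) next ⟨
      Σ (map (suc ∘ toℕ) (allFin N)) next
        ≡⟨ cong (λ xs → Σ xs next) (allFin-range N) ⟩
      Σ spots next
        ∎
      where
      next : ℕ → Carrier
      next y = luck occ y ⊛ circularSum (park occ y ∷ occ) k (isFree N)

    linearSum-first-car k occ x nothing N-free found = begin
      Σ (allVecs N k) (λ v → weight (run M occ (x ∷ v)))
        ≈⟨ Σ-cong (allVecs N k) (λ v → weight-run-blocked occ x v found) ⟩
      Σ (allVecs N k) (λ _ → 0#)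
        ≈⟨ Σ-zero (allVecs N k) ⟩
      0#
        ≈⟨ ≈-trans (*-cong ≈-refl (circularSum-occupied k (N ∷ occ) N (elemᵇ-here N occ))) (zeroʳ _) ⟨
      luck occ (suc (toℕ x)) ⊛ circularSum (N ∷ occ) k (isFree N)
        ≡⟨ cong (λ s → luck occ (suc (toℕ x)) ⊛ circularSum (s ∷ occ) k (isFree N))
                (park-firstFree occ x N-free found) ⟨
      luck occ (suc (toℕ x)) ⊛ circularSum (park occ (suc (toℕ x)) ∷ occ) k (isFree N)
        ∎
    linearSum-first-car k occ x (just t) N-free found = begin
      Σ (allVecs N k) (λ v → weight (run M occ (x ∷ v)))
        ≈⟨ Σ-cong (allVecs N k) (λ v → weight-run-parks occ x v found) ⟩
      Σ (allVecs N k) (λ v → (if t ≡ᵇ suc (toℕ x) then u else 1#) ⊛ weight (run M (t ∷ occ) v))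
        ≈⟨ Σ-*ˡ _ (allVecs N k) _ ⟨
      (if t ≡ᵇ suc (toℕ x) then u else 1#) ⊛ linearSum (t ∷ occ) k
        ≈⟨ *-cong ≈-refl (linearSum-circularSum k (t ∷ occ) N-still-free) ⟩
      (if t ≡ᵇ suc (toℕ x) then u else 1#) ⊛ circularSum (t ∷ occ) k (isFree N)
        ≡⟨ cong (λ s → (if s ≡ᵇ suc (toℕ x) then u else 1#) ⊛ circularSum (s ∷ occ) k (isFree N))
                (park-firstFree occ x N-free found) ⟨
      luck occ (suc (toℕ x)) ⊛ circularSum (park occ (suc (toℕ x)) ∷ occ) k (isFree N)
        ∎
      where
      N-still-free : elemᵇ N (t ∷ occ) ≡ false
      N-still-free = trans (elemᵇ-∷-≢ occ (λ N≡t → ℕ.<⇒≢ (firstFree-<N occ x found) (sym N≡t))) N-free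

  module Product (m c : ℕ) where
    open Circle (m + c) using (N)
    open Circular (m + c) using (stepProduct)

    factor : ℕ → Carrier
    factor i = (nat R i ⊛ 1# ⊕ nat R (suc m ∸ i) ⊛ u) ⊕ nat R c ⊛ u

    stepProduct-factor : ∀ s r → s + suc r ≡ m →
                         nat R (N ∸ (suc r + c)) ⊕ nat R (suc r + c) ⊛ u ≈ factor (suc s)
    stepProduct-factor s r s+r≡m = begin
      nat R (N ∸ (suc r + c)) ⊕ nat R (suc r + c) ⊛ u
        ≡⟨ cong (λ k → nat R k ⊕ nat R (suc r + c) ⊛ u) occupied ⟩
      nat R (suc s) ⊕ nat R (suc r + c) ⊛ u
        ≈⟨ +-cong (≈-sym (*-identityʳ _)) (*-cong (nat-+ (suc r) c) ≈-refl) ⟩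
      nat R (suc s) ⊛ 1# ⊕ (nat R (suc r) ⊕ nat R c) ⊛ u
        ≈⟨ +-cong ≈-refl (distribʳ u _ _) ⟩
      nat R (suc s) ⊛ 1# ⊕ (nat R (suc r) ⊛ u ⊕ nat R c ⊛ u)
        ≈⟨ +-assoc _ _ _ ⟨
      (nat R (suc s) ⊛ 1# ⊕ nat R (suc r) ⊛ u) ⊕ nat R c ⊛ u
        ≡⟨ cong (λ k → (nat R (suc s) ⊛ 1# ⊕ nat R k ⊛ u) ⊕ nat R c ⊛ u) pending ⟨
      factor (suc s)
        ∎
      where
      occupied : N ∸ (suc r + c) ≡ suc s
      occupied = trans (cong (λ k → k + c ∸ (r + c)) (trans (sym s+r≡m) (ℕ.+-suc s r)))
                     (trans (cong (_∸ (r + c)) (ℕ.+-assoc (suc s) r c)) (ℕ.m+n∸n≡m (suc s) (r + c)))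
      pending : suc m ∸ suc s ≡ suc r
      pending = trans (cong (_∸ s) (sym s+r≡m)) (ℕ.m+n∸m≡n s (suc r))

    prodFrom1-stepProduct : ∀ s r → s + r ≡ m →
                            prodFrom1 R s factor ⊛ stepProduct (r + c) r ≈ prodFrom1 R m factor
    prodFrom1-stepProduct s zero    s+0≡m = ≈-trans (*-identityʳ _)
      (reflexive (cong (λ k → prodFrom1 R k factor) (trans (sym (ℕ.+-identityʳ s)) s+0≡m)))
    prodFrom1-stepProduct s (suc r) s+r≡m = begin
      prodFrom1 R s factor ⊛ ((nat R (N ∸ (suc r + c)) ⊕ nat R (suc r + c) ⊛ u) ⊛ stepProduct (r + c) r)
        ≈⟨ *-cong ≈-refl (*-cong (stepProduct-factor s r s+r≡m) ≈-refl) ⟩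
      prodFrom1 R s factor ⊛ (factor (suc s) ⊛ stepProduct (r + c) r)
        ≈⟨ *-assoc _ _ _ ⟨
      prodFrom1 R (suc s) factor ⊛ stepProduct (r + c) r
        ≈⟨ prodFrom1-stepProduct (suc s) r (trans (sym (ℕ.+-suc s r)) s+r≡m) ⟩
      prodFrom1 R m factor
        ∎

    stepProduct-prodFrom1 : stepProduct (m + c) m ≈ prodFrom1 R m factor
    stepProduct-prodFrom1 = ≈-trans (≈-sym (*-identityˡ _)) (prodFrom1-stepProduct 0 m refl)

corollary10p2 : {a ℓ : Level} (R : CommutativeSemiring a ℓ) →
    (c : ℕ) → 1 Data.Nat.≤ c → (n : ℕ) → (u : CommutativeSemiring.Carrier R) →
    CommutativeSemiring._≈_ R (luckySum R n c u)
      (P R n (CommutativeSemiring.1# R) u (CommutativeSemiring._*_ R (nat R c) u))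
corollary10p2 R c _ zero    u = CommutativeSemiring.+-identityʳ R (CommutativeSemiring.1# R)
corollary10p2 R c _ (suc m) u = begin
  luckySum R (suc m) c u                             ≈⟨ luckySum-Σ (suc m) c ⟩
  linearSum [] (suc m)                               ≈⟨ linearSum-circularSum (suc m) [] refl ⟩
  circularSum [] (suc m) (isFree (suc m + c))        ≈⟨ circularSum-N-free m ⟩
  u * (nat R (m + c ∸ m) * stepProduct (m + c) m)    ≈⟨ *-cong ≈-refl (*-cong c-left-empty stepProduct-prodFrom1) ⟩
  u * (nat R c * prodFrom1 R m factor)               ≈⟨ *-assoc u _ _ ⟨
  (u * nat R c) * prodFrom1 R m factor               ≈⟨ *-cong (*-comm u (nat R c)) ≈-refl ⟩
  (nat R c * u) * prodFrom1 R m factor               ∎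
  where
  open CommutativeSemiring R using (setoid; _≈_; _*_; *-cong; *-assoc; *-comm; reflexive) renaming (refl to ≈-refl)
  open Relation.Binary.Reasoning.Setoid setoid
  open Parking R u
  open Circular (m + c)
  open Product m c

  c-left-empty : nat R (m + c ∸ m) ≈ nat R c
  c-left-empty = reflexive (cong (nat R) (ℕ.m+n∸m≡n m c))
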